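{- Let $I=(U_1,\dots,U_p,\mathcal{S},k)$ be an instance of RP-$d$-SP such that $\mathcal{S}$ has a hitting set of size at most $k\cdot d$. Suppose $\mathcal{F}\subseteq\mathcal{S}$ is a sunflower with core $Y$ consisting of $d(k\cdot d-1)+2$ sets such that (1) no petal $F\setminus Y$, $F\in\mathcal{F}$, is intersected by an internal set (a set of $\mathcal{S}$ that is $j$-internal for some agent $j$), and (2) for each agent $i$ that has an $i$-internal set intersecting $Y$, and for all $F,F'\in\mathcal{F}$, $|F\cap U_i|=|F'\cap U_i|$. Let $F\in\mathcal{F}$ be a set of minimum size. Then $I$ is a YES-instance if and only if $I'=(U_1,\dots,U_p,\mathcal{S}\setminus\{F\},k)$ is a YES-instance. (That is, Reduction Rule 2, which removes such a set $F$, is safe.)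
   Context: An instance of RP-$d$-SP consists of a finite universe $U=U_1\cup\dots\cup U_p$ partitioned among $p$ agents, a collection $\mathcal{S}\subseteq 2^U$ of sets each of size at most $d$, and an integer $k$. A set $S$ is $i$-internal if $S\subseteq U_i$. For a collection $\mathcal{X}\subseteq\mathcal{S}$ of pairwise disjoint sets, agent $i$ rejects $\mathcal{X}$ if there exist $\mathcal{X}_{\mathrm{rej}}\subseteq\mathcal{X}$ and a collection $\mathcal{X}_{\mathrm{int}}\subseteq\mathcal{S}$ of $i$-internal sets such that $(\mathcal{X}\setminus\mathcal{X}_{\mathrm{rej}})\cup\mathcal{X}_{\mathrm{int}}$ consists of pairwise disjoint sets and covers more elements of $U_i$ than $\mathcal{X}$ does; $\mathcal{X}$ is rejection-proof if no agent rejects it. The instance is a YES-instance if there is a rejection-proof collection of pairwise disjoint sets from $\mathcal{S}$ covering at least $k$ elements. A hitting set of $\mathcal{S}$ is a subset of $U$ meeting every set of $\mathcal{S}$. A sunflower with core $Y$ is a collection of sets whose pairwise intersections all equal $Y$, with all petals $S\setminus Y$ non-empty. -}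

module Defs where

open import Data.Nat using (ℕ; _+_; _*_; _∸_; _≤_; _<_)
open import Data.Bool using (Bool)
import Data.Bool.Properties as BoolP
open import Data.Fin using (Fin)
import Data.Fin.Properties as FinP
open import Data.Fin.Subset using (Subset; _∈_; _∉_; _⊆_; _∩_; ⋃; ∣_∣; Nonempty; Empty)
open import Data.Vec using (tabulate)
open import Data.Vec.Properties using (≡-dec)
open import Data.List using (List; filter; _++_; length)
open import Data.List.Membership.Propositional using () renaming (_∈_ to _∈ˡ_)
open import Data.List.Membership.DecPropositional using () renaming (_∈?_ to ∈ˡ?)
open import Data.List.Relation.Unary.Unique.Propositional using (Unique)
open import Data.Product using (Σ; ∃; ∃-syntax; _×_)
open import Data.Sum using (_⊎_)
open import Relation.Nullary using (¬_; Dec; does)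
open import Relation.Nullary.Decidable using (⌊_⌋; ¬?)
open import Relation.Binary.PropositionalEquality using (_≡_; _≢_)
open import Relation.Binary using (DecidableEquality)

-- Universe: Fin n.  The partition U_1,…,U_p is given by an owner map
-- own : Fin n → Fin p  (U_i = own⁻¹(i)).  Collections of sets are lists of subsets.

_≟ˢ_ : ∀ {n} → DecidableEquality (Subset n)
_≟ˢ_ = ≡-dec BoolP._≟_

U : ∀ {n p} → (Fin n → Fin p) → Fin p → Subset n
U own i = tabulate (λ x → ⌊ own x FinP.≟ i ⌋)

_⊆ᶜ_ : ∀ {n} → List (Subset n) → List (Subset n) → Set
𝒳 ⊆ᶜ 𝒴 = ∀ {S} → S ∈ˡ 𝒳 → S ∈ˡ 𝒴

_∖ᶜ_ : ∀ {n} → List (Subset n) → List (Subset n) → List (Subset n)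
𝒳 ∖ᶜ 𝒴 = filter (λ S → ¬? (∈ˡ? _≟ˢ_ S 𝒴)) 𝒳

remove : ∀ {n} → List (Subset n) → Subset n → List (Subset n)
remove 𝒮 F = filter (λ S → ¬? (S ≟ˢ F)) 𝒮

PairwiseDisjoint : ∀ {n} → List (Subset n) → Set
PairwiseDisjoint 𝒳 = ∀ {S T} → S ∈ˡ 𝒳 → T ∈ˡ 𝒳 → S ≢ T → Empty (S ∩ T)

Internalᵢ : ∀ {n p} → (Fin n → Fin p) → Fin p → Subset n → Set
Internalᵢ own i S = S ⊆ U own i

Internal : ∀ {n p} → (Fin n → Fin p) → Subset n → Set
Internal own S = ∃[ j ] Internalᵢ own j S

coverᵢ : ∀ {n p} → (Fin n → Fin p) → Fin p → List (Subset n) → ℕ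
coverᵢ own i 𝒳 = ∣ ⋃ 𝒳 ∩ U own i ∣

Rejects : ∀ {n p} → (Fin n → Fin p) → List (Subset n) → Fin p → List (Subset n) → Set
Rejects own 𝒮 i 𝒳 =
  Σ (List _) λ 𝒳rej → Σ (List _) λ 𝒳int →
    𝒳rej ⊆ᶜ 𝒳 ×
    𝒳int ⊆ᶜ 𝒮 ×
    (∀ {S} → S ∈ˡ 𝒳int → Internalᵢ own i S) ×
    PairwiseDisjoint ((𝒳 ∖ᶜ 𝒳rej) ++ 𝒳int) ×
    coverᵢ own i 𝒳 < coverᵢ own i ((𝒳 ∖ᶜ 𝒳rej) ++ 𝒳int)

RejectionProof : ∀ {n p} → (Fin n → Fin p) → List (Subset n) → List (Subset n) → Set
RejectionProof own 𝒮 𝒳 = ∀ i → ¬ Rejects own 𝒮 i 𝒳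

YesInstance : ∀ {n p} → (Fin n → Fin p) → List (Subset n) → ℕ → Set
YesInstance own 𝒮 k =
  Σ (List _) λ 𝒳 →
    𝒳 ⊆ᶜ 𝒮 × PairwiseDisjoint 𝒳 × RejectionProof own 𝒮 𝒳 × k ≤ ∣ ⋃ 𝒳 ∣

SizeBounded : ∀ {n} → ℕ → List (Subset n) → Set
SizeBounded d 𝒮 = ∀ {S} → S ∈ˡ 𝒮 → ∣ S ∣ ≤ d

HittingSet : ∀ {n} → List (Subset n) → Subset n → Set
HittingSet 𝒮 H = ∀ {S} → S ∈ˡ 𝒮 → Nonempty (S ∩ H)

Sunflower : ∀ {n} → List (Subset n) → Subset n → Set
Sunflower 𝓕 Y =
  Unique 𝓕 ×
  (∀ {F F'} → F ∈ˡ 𝓕 → F' ∈ˡ 𝓕 → F ≢ F' → F ∩ F' ≡ Y) ×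
  (∀ {F} → F ∈ˡ 𝓕 → ∃[ x ] (x ∈ F × x ∉ Y))

{-# OPTIONS --safe #-}
-- Internal sets meet the sunflower only inside its core, so no member of 𝓕 is internal:
-- 𝒮 and 𝒮 ∖ {F} offer every agent the same internal sets, hence the same rejections, and a
-- solution avoiding F solves both instances.
-- A solution 𝒳 containing F is repaired by exchanging F for another member F' of 𝓕. The sets
-- of 𝒳 are disjoint and each meets the hitting set H, so besides F there are at most kd − 1 of
-- them, covering at most d(kd − 1) elements, none of them in the core. Petals being disjoint,
-- at most d(kd − 1) petals are hit, which leaves some F' ≠ F disjoint from all these sets;
-- |F| ≤ |F'| keeps the coverage. An agent rejecting the new collection already rejects 𝒳,
-- by a case analysis on whether F' is rejected and whether the added internal sets meet the core.
module Submission where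

open import Defs
open import Data.Nat using (ℕ; _+_; _*_; _∸_; _≤_)
open import Data.Fin using (Fin)
open import Data.Fin.Subset using (Subset; _∈_; _∉_; _∩_; ∣_∣; Nonempty)
open import Data.List using (List; length)
open import Data.List.Membership.Propositional using () renaming (_∈_ to _∈ˡ_)
open import Data.Product using (Σ; ∃-syntax; _×_)
open import Relation.Binary.PropositionalEquality using (_≡_)
open import Function.Bundles using (_⇔_)
open import Data.Empty using (⊥)

open import Data.Nat using (suc; _<_; pred; z≤n; s≤s)
open import Data.Nat.Properties
  using (+-suc; +-identityʳ; +-comm; m≤m+n; m≤n+m; m<n+m; ≤-trans; <-≤-trans; ≤-pred; <⇒≤pred;
         +-monoˡ-≤; +-monoʳ-≤; +-monoˡ-<; *-monoʳ-≤; *-suc; ∸-monoˡ-≤;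
         +-cancelʳ-≤; +-cancelʳ-<; +-cancelʳ-≡; ≤-reflexive; module ≤-Reasoning)
open import Data.Fin.Subset using (_∪_; ⋃; ⊤; _-_; _⊆_; Empty; outside; inside; ⁅_⁆)
open import Data.Fin.Subset.Properties
  using (x∈p∪q⁻; x∈p∪q⁺; x∈p∩q⁻; x∈p∩q⁺; ∉⊥; ⊆-antisym; ∣⊥∣≡0; Empty-unique; ∩-identityʳ;
         ∩-comm; ∩-distribʳ-∪; ∣p∩q∣≤∣q∣; x∈p⇒∣p-x∣<∣p∣; x∈p∧x≢y⇒x∈p-y; p─q⊆p;
         p∩q⊆p; q⊆p∪q; nonempty?; x∈⁅x⁆; x∈⁅y⁆⇒x≡y; ∣⁅x⁆∣≡1; ∩-idempotentCommutativeMonoid)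
  renaming (_∈?_ to _∈ˢ?_)
import Algebra.Properties.IdempotentCommutativeMonoid as ICM
import Data.Fin.Properties as FinP
open import Data.Vec using ([]; _∷_)
open import Data.List using ([]; _∷_; _++_)
open import Data.List.Relation.Unary.Any using (Any; here; there; any?)
open import Data.List.Relation.Unary.All using (_∷_) renaming (lookup to All-lookup)
open import Data.List.Relation.Unary.AllPairs using (_∷_)
open import Data.List.Relation.Unary.Unique.Propositional using (Unique)
open import Data.List.Membership.Propositional using (find; lose)
open import Data.List.Membership.Propositional.Properties using (∈-filter⁺; ∈-filter⁻; ∈-++⁺ˡ; ∈-++⁺ʳ; ∈-++⁻)
import Data.List.Membership.DecPropositional as DecMembership
open import Data.List.Relation.Binary.Subset.Propositional.Properties using (⊆-trans; ∷⁺ʳ; ∈-∷⁺ʳ; ++⁺ˡ)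
open import Data.Product using (_,_; proj₁; proj₂; map₁; map₂)
open import Data.Sum using (inj₁; inj₂; [_,_]′)
open import Data.Empty using (⊥-elim)
open import Function using (_∘_)
open import Relation.Nullary using (¬_; Dec; yes; no; ¬?)
open import Relation.Nullary.Decidable using (decidable-stable)
open import Relation.Binary.PropositionalEquality using (refl; sym; trans; cong; cong₂; subst; subst₂; _≢_; ≢-sym; module ≡-Reasoning)
open import Function.Bundles using (mk⇔)

private
  variable
    n : ℕ
    p q r : Subset n

p⊆q⇒q∩r≡∅⇒p∩r≡∅ : p ⊆ q → Empty (q ∩ r) → Empty (p ∩ r)
p⊆q⇒q∩r≡∅⇒p∩r≡∅ {p = p} {r = r} p⊆q q∩r≡∅ (x , x∈p∩r) =
  let x∈p , x∈r = x∈p∩q⁻ p r x∈p∩r in q∩r≡∅ (x , x∈p∩q⁺ (p⊆q x∈p , x∈r))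

q⊆r⇒p∩r≡∅⇒p∩q≡∅ : q ⊆ r → Empty (p ∩ r) → Empty (p ∩ q)
q⊆r⇒p∩r≡∅⇒p∩q≡∅ {q = q} {p = p} q⊆r p∩r≡∅ (x , x∈p∩q) =
  let x∈p , x∈q = x∈p∩q⁻ p q x∈p∩q in p∩r≡∅ (x , x∈p∩q⁺ (x∈p , q⊆r x∈q))

x∉p⇒p∩[q-x]≡∅⇒p∩q≡∅ : ∀ {x : Fin n} → x ∉ p → Empty (p ∩ (q - x)) → Empty (p ∩ q)
x∉p⇒p∩[q-x]≡∅⇒p∩q≡∅ {p = p} {q} {x} x∉p p∩[q-x]≡∅ (y , y∈p∩q) with x∈p∩q⁻ p q y∈p∩q | y FinP.≟ x
... | y∈p , _   | yes refl = x∉p y∈p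
... | y∈p , y∈q | no y≢x   = p∩[q-x]≡∅ (y , x∈p∩q⁺ (y∈p , x∈p∧x≢y⇒x∈p-y y∈q y≢x))

∣p∪q∣+∣p∩q∣≡∣p∣+∣q∣ : (p q : Subset n) → ∣ p ∪ q ∣ + ∣ p ∩ q ∣ ≡ ∣ p ∣ + ∣ q ∣
∣p∪q∣+∣p∩q∣≡∣p∣+∣q∣ []            []            = refl
∣p∪q∣+∣p∩q∣≡∣p∣+∣q∣ (outside ∷ p) (outside ∷ q) = ∣p∪q∣+∣p∩q∣≡∣p∣+∣q∣ p q
∣p∪q∣+∣p∩q∣≡∣p∣+∣q∣ (inside  ∷ p) (outside ∷ q) = cong suc (∣p∪q∣+∣p∩q∣≡∣p∣+∣q∣ p q)
∣p∪q∣+∣p∩q∣≡∣p∣+∣q∣ (outside ∷ p) (inside  ∷ q) =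
  trans (cong suc (∣p∪q∣+∣p∩q∣≡∣p∣+∣q∣ p q)) (sym (+-suc ∣ p ∣ ∣ q ∣))
∣p∪q∣+∣p∩q∣≡∣p∣+∣q∣ (inside  ∷ p) (inside  ∷ q) = cong suc (begin
  ∣ p ∪ q ∣ + suc ∣ p ∩ q ∣   ≡⟨ +-suc ∣ p ∪ q ∣ ∣ p ∩ q ∣ ⟩
  suc (∣ p ∪ q ∣ + ∣ p ∩ q ∣) ≡⟨ cong suc (∣p∪q∣+∣p∩q∣≡∣p∣+∣q∣ p q) ⟩
  suc (∣ p ∣ + ∣ q ∣)         ≡⟨ +-suc ∣ p ∣ ∣ q ∣ ⟨
  ∣ p ∣ + suc ∣ q ∣           ∎)
  where open ≡-Reasoning

∣p∪q∣≤∣p∣+∣q∣ : (p q : Subset n) → ∣ p ∪ q ∣ ≤ ∣ p ∣ + ∣ q ∣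
∣p∪q∣≤∣p∣+∣q∣ p q = ≤-trans (m≤m+n ∣ p ∪ q ∣ ∣ p ∩ q ∣) (≤-reflexive (∣p∪q∣+∣p∩q∣≡∣p∣+∣q∣ p q))

p∩q≡∅⇒∣p∪q∣≡∣p∣+∣q∣ : Empty (p ∩ q) → ∣ p ∪ q ∣ ≡ ∣ p ∣ + ∣ q ∣
p∩q≡∅⇒∣p∪q∣≡∣p∣+∣q∣ {n} {p} {q} p∩q≡∅ = begin
  ∣ p ∪ q ∣               ≡⟨ +-identityʳ ∣ p ∪ q ∣ ⟨
  ∣ p ∪ q ∣ + 0           ≡⟨ cong (∣ p ∪ q ∣ +_) ∣p∩q∣≡0 ⟨
  ∣ p ∪ q ∣ + ∣ p ∩ q ∣   ≡⟨ ∣p∪q∣+∣p∩q∣≡∣p∣+∣q∣ p q ⟩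
  ∣ p ∣ + ∣ q ∣           ∎
  where
  open ≡-Reasoning
  ∣p∩q∣≡0 : ∣ p ∩ q ∣ ≡ 0
  ∣p∩q∣≡0 = trans (cong ∣_∣ (Empty-unique p∩q≡∅)) (∣⊥∣≡0 n)

∣[p∪q]∩r∣+∣[p∩q]∩r∣≡∣p∩r∣+∣q∩r∣ : (p q r : Subset n) →
  ∣ (p ∪ q) ∩ r ∣ + ∣ (p ∩ q) ∩ r ∣ ≡ ∣ p ∩ r ∣ + ∣ q ∩ r ∣
∣[p∪q]∩r∣+∣[p∩q]∩r∣≡∣p∩r∣+∣q∩r∣ {n} p q r = begin
  ∣ (p ∪ q) ∩ r ∣ + ∣ (p ∩ q) ∩ r ∣
    ≡⟨ cong₂ (λ s t → ∣ s ∣ + ∣ t ∣) (∩-distribʳ-∪ r p q) (∩.∙-distrʳ-∙ r p q) ⟩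
  ∣ (p ∩ r) ∪ (q ∩ r) ∣ + ∣ (p ∩ r) ∩ (q ∩ r) ∣
    ≡⟨ ∣p∪q∣+∣p∩q∣≡∣p∣+∣q∣ (p ∩ r) (q ∩ r) ⟩
  ∣ p ∩ r ∣ + ∣ q ∩ r ∣ ∎
  where
  open ≡-Reasoning
  module ∩ = ICM (∩-idempotentCommutativeMonoid n)

p∩q≡∅⇒∣[p∪q]∩r∣≡∣p∩r∣+∣q∩r∣ : Empty (p ∩ q) → ∀ r → ∣ (p ∪ q) ∩ r ∣ ≡ ∣ p ∩ r ∣ + ∣ q ∩ r ∣
p∩q≡∅⇒∣[p∪q]∩r∣≡∣p∩r∣+∣q∩r∣ {p = p} {q} p∩q≡∅ r =
  trans (cong ∣_∣ (∩-distribʳ-∪ r p q))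
        (p∩q≡∅⇒∣p∪q∣≡∣p∣+∣q∣ (q⊆r⇒p∩r≡∅⇒p∩q≡∅ (p∩q⊆p q r) (p⊆q⇒q∩r≡∅⇒p∩r≡∅ (p∩q⊆p p r) p∩q≡∅)))

∣p∩⊤∣≡∣p∣ : (p : Subset n) → ∣ p ∩ ⊤ ∣ ≡ ∣ p ∣
∣p∩⊤∣≡∣p∣ p = cong ∣_∣ (∩-identityʳ p)

p≢∅⇒0<∣p∣ : Nonempty p → 0 < ∣ p ∣
p≢∅⇒0<∣p∣ (x , x∈p) = <-≤-trans (s≤s z≤n) (x∈p⇒∣p-x∣<∣p∣ x∈p)

_∈ˡ?_ : (S : Subset n) (𝒳 : List (Subset n)) → Dec (S ∈ˡ 𝒳)
S ∈ˡ? 𝒳 = DecMembership._∈?_ _≟ˢ_ S 𝒳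

private
  variable
    S F : Subset n
    𝒳 𝒴 ℛ : List (Subset n)

x∈⋃⁺ : ∀ {x} → S ∈ˡ 𝒳 → x ∈ S → x ∈ ⋃ 𝒳
x∈⋃⁺ (here refl) x∈S = x∈p∪q⁺ (inj₁ x∈S)
x∈⋃⁺ (there S∈𝒳) x∈S = x∈p∪q⁺ (inj₂ (x∈⋃⁺ S∈𝒳 x∈S))

x∈⋃⁻ : ∀ (𝒳 : List (Subset n)) {x} → x ∈ ⋃ 𝒳 → ∃[ S ] (S ∈ˡ 𝒳 × x ∈ S)
x∈⋃⁻ []      x∈⋃ = ⊥-elim (∉⊥ x∈⋃)
x∈⋃⁻ (S ∷ 𝒳) x∈⋃ with x∈p∪q⁻ S (⋃ 𝒳) x∈⋃
... | inj₁ x∈S  = S , here refl , x∈S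
... | inj₂ x∈⋃𝒳 = map₂ (map₁ there) (x∈⋃⁻ 𝒳 x∈⋃𝒳)

⋃-mono : 𝒳 ⊆ᶜ 𝒴 → ⋃ 𝒳 ⊆ ⋃ 𝒴
⋃-mono {𝒳 = 𝒳} 𝒳⊆𝒴 x∈⋃𝒳 = let S , S∈𝒳 , x∈S = x∈⋃⁻ 𝒳 x∈⋃𝒳 in x∈⋃⁺ (𝒳⊆𝒴 S∈𝒳) x∈S

⋃-cong : 𝒳 ⊆ᶜ 𝒴 → 𝒴 ⊆ᶜ 𝒳 → ⋃ 𝒳 ≡ ⋃ 𝒴
⋃-cong 𝒳⊆𝒴 𝒴⊆𝒳 = ⊆-antisym (⋃-mono 𝒳⊆𝒴) (⋃-mono 𝒴⊆𝒳)

p∩⋃≡∅ : (∀ {T} → T ∈ˡ 𝒳 → Empty (p ∩ T)) → Empty (p ∩ ⋃ 𝒳)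
p∩⋃≡∅ {𝒳 = 𝒳} {p = p} p∩T≡∅ (x , x∈) =
  let x∈p , x∈⋃𝒳 = x∈p∩q⁻ p (⋃ 𝒳) x∈
      T , T∈𝒳 , x∈T = x∈⋃⁻ 𝒳 x∈⋃𝒳
  in p∩T≡∅ T∈𝒳 (x , x∈p∩q⁺ (x∈p , x∈T))

∈-remove⁺ : S ∈ˡ 𝒳 → S ≢ F → S ∈ˡ remove 𝒳 F
∈-remove⁺ {F = F} = ∈-filter⁺ (λ S → ¬? (S ≟ˢ F))

∈-remove⁻ : S ∈ˡ remove 𝒳 F → S ∈ˡ 𝒳 × S ≢ F
∈-remove⁻ {F = F} = ∈-filter⁻ (λ S → ¬? (S ≟ˢ F))

∈-∖ᶜ⁺ : S ∈ˡ 𝒳 → ¬ (S ∈ˡ ℛ) → S ∈ˡ (𝒳 ∖ᶜ ℛ)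
∈-∖ᶜ⁺ {ℛ = ℛ} = ∈-filter⁺ (λ S → ¬? (S ∈ˡ? ℛ))

∈-∖ᶜ⁻ : S ∈ˡ (𝒳 ∖ᶜ ℛ) → S ∈ˡ 𝒳 × ¬ (S ∈ˡ ℛ)
∈-∖ᶜ⁻ {ℛ = ℛ} = ∈-filter⁻ (λ S → ¬? (S ∈ˡ? ℛ))

∖ᶜ-⊆-∷ : (𝒳 ∖ᶜ ℛ) ⊆ᶜ (F ∷ (𝒳 ∖ᶜ (F ∷ ℛ)))
∖ᶜ-⊆-∷ {𝒳 = 𝒳} {ℛ = ℛ} {F = F} {S} S∈ with S ≟ˢ F
... | yes refl = here refl
... | no S≢F   =
  let S∈𝒳 , S∉ℛ = ∈-∖ᶜ⁻ {𝒳 = 𝒳} {ℛ} S∈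
  in there (∈-∖ᶜ⁺ S∈𝒳 λ { (here S≡F) → S≢F S≡F ; (there S∈ℛ) → S∉ℛ S∈ℛ })

∷-∖ᶜ-⊆ : F ∈ˡ 𝒳 → ¬ (F ∈ˡ ℛ) → (F ∷ (𝒳 ∖ᶜ (F ∷ ℛ))) ⊆ᶜ (𝒳 ∖ᶜ ℛ)
∷-∖ᶜ-⊆ F∈𝒳 F∉ℛ (here refl) = ∈-∖ᶜ⁺ F∈𝒳 F∉ℛ
∷-∖ᶜ-⊆ {𝒳 = 𝒳} {ℛ = ℛ} F∈𝒳 F∉ℛ (there S∈) =
  let S∈𝒳 , S∉F∷ℛ = ∈-∖ᶜ⁻ {𝒳 = 𝒳} {_ ∷ ℛ} S∈ in ∈-∖ᶜ⁺ S∈𝒳 (S∉F∷ℛ ∘ there)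

PairwiseDisjoint-⊆ : 𝒳 ⊆ᶜ 𝒴 → PairwiseDisjoint 𝒴 → PairwiseDisjoint 𝒳
PairwiseDisjoint-⊆ 𝒳⊆𝒴 disjoint S∈ T∈ = disjoint (𝒳⊆𝒴 S∈) (𝒳⊆𝒴 T∈)

PairwiseDisjoint-∷ : (∀ {T} → T ∈ˡ 𝒳 → Empty (S ∩ T)) → PairwiseDisjoint 𝒳 → PairwiseDisjoint (S ∷ 𝒳)
PairwiseDisjoint-∷ S∩T≡∅ disjoint (here refl) (here refl) S≢S = ⊥-elim (S≢S refl)
PairwiseDisjoint-∷ S∩T≡∅ disjoint (here refl) (there T∈)  _   = S∩T≡∅ T∈
PairwiseDisjoint-∷ {S = S} S∩T≡∅ disjoint {T} (there T∈) (here refl) _ = subst Empty (∩-comm S T) (S∩T≡∅ T∈)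
PairwiseDisjoint-∷ S∩T≡∅ disjoint (there S∈)  (there T∈)  = disjoint S∈ T∈

∪-⋃-absorb : S ∈ˡ 𝒳 → S ∪ ⋃ 𝒳 ≡ ⋃ 𝒳
∪-⋃-absorb {S = S} {𝒳 = 𝒳} S∈𝒳 = ⊆-antisym (λ x∈ → [ x∈⋃⁺ S∈𝒳 , (λ x∈⋃𝒳 → x∈⋃𝒳) ]′ (x∈p∪q⁻ S (⋃ 𝒳) x∈)) (q⊆p∪q S (⋃ 𝒳))

∣⋃∣≤d*∣⋃∩H∣ : ∀ (d : ℕ) (H : Subset n) (𝒳 : List (Subset n)) → PairwiseDisjoint 𝒳 →
  (∀ {S} → S ∈ˡ 𝒳 → ∣ S ∣ ≤ d) → (∀ {S} → S ∈ˡ 𝒳 → Nonempty (S ∩ H)) →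
  ∣ ⋃ 𝒳 ∣ ≤ d * ∣ ⋃ 𝒳 ∩ H ∣
∣⋃∣≤d*∣⋃∩H∣ {n} d H [] _ _ _ = subst (_≤ d * ∣ ⋃ [] ∩ H ∣) (sym (∣⊥∣≡0 n)) z≤n
∣⋃∣≤d*∣⋃∩H∣ d H (S ∷ 𝒳) disjoint ∣_∣≤d hits = extend (S ∈ˡ? 𝒳)
  where
  ih : ∣ ⋃ 𝒳 ∣ ≤ d * ∣ ⋃ 𝒳 ∩ H ∣
  ih = ∣⋃∣≤d*∣⋃∩H∣ d H 𝒳 (PairwiseDisjoint-⊆ there disjoint) (∣_∣≤d ∘ there) (hits ∘ there)

  extend : Dec (S ∈ˡ 𝒳) → ∣ S ∪ ⋃ 𝒳 ∣ ≤ d * ∣ (S ∪ ⋃ 𝒳) ∩ H ∣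
  extend (yes S∈𝒳) = subst (λ U → ∣ U ∣ ≤ d * ∣ U ∩ H ∣) (sym (∪-⋃-absorb S∈𝒳)) ih
  extend (no S∉𝒳) = begin
    ∣ S ∪ ⋃ 𝒳 ∣                   ≡⟨ p∩q≡∅⇒∣p∪q∣≡∣p∣+∣q∣ S∩⋃𝒳≡∅ ⟩
    ∣ S ∣ + ∣ ⋃ 𝒳 ∣               ≤⟨ +-monoˡ-≤ ∣ ⋃ 𝒳 ∣ (∣_∣≤d (here refl)) ⟩
    d + ∣ ⋃ 𝒳 ∣                   ≤⟨ +-monoʳ-≤ d ih ⟩
    d + d * ∣ ⋃ 𝒳 ∩ H ∣           ≡⟨ *-suc d ∣ ⋃ 𝒳 ∩ H ∣ ⟨
    d * suc ∣ ⋃ 𝒳 ∩ H ∣           ≤⟨ *-monoʳ-≤ d (+-monoˡ-≤ ∣ ⋃ 𝒳 ∩ H ∣ (p≢∅⇒0<∣p∣ (hits (here refl)))) ⟩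
    d * (∣ S ∩ H ∣ + ∣ ⋃ 𝒳 ∩ H ∣) ≡⟨ cong (d *_) (p∩q≡∅⇒∣[p∪q]∩r∣≡∣p∩r∣+∣q∩r∣ S∩⋃𝒳≡∅ H) ⟨
    d * ∣ (S ∪ ⋃ 𝒳) ∩ H ∣         ∎
    where
    open ≤-Reasoning
    S∩⋃𝒳≡∅ : Empty (S ∩ ⋃ 𝒳)
    S∩⋃𝒳≡∅ = p∩⋃≡∅ λ T∈𝒳 → disjoint (here refl) (there T∈𝒳) (λ { refl → S∉𝒳 T∈𝒳 })

p∩⋃[remove]≡∅ : PairwiseDisjoint 𝒳 → F ∈ˡ 𝒳 → Empty (F ∩ ⋃ (remove 𝒳 F))
p∩⋃[remove]≡∅ disjoint F∈𝒳 = p∩⋃≡∅ λ T∈ → let T∈𝒳 , T≢F = ∈-remove⁻ T∈ in disjoint F∈𝒳 T∈𝒳 (≢-sym T≢F)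

∣⋃[remove]∣≤d*pred∣H∣ : ∀ (d : ℕ) (H : Subset n) → PairwiseDisjoint 𝒳 →
  (∀ {S} → S ∈ˡ 𝒳 → ∣ S ∣ ≤ d) → (∀ {S} → S ∈ˡ 𝒳 → Nonempty (S ∩ H)) →
  F ∈ˡ 𝒳 → ∣ ⋃ (remove 𝒳 F) ∣ ≤ d * pred ∣ H ∣
∣⋃[remove]∣≤d*pred∣H∣ {n} {𝒳 = 𝒳} {F = F} d H disjoint ∣_∣≤d hits F∈𝒳 =
  ≤-trans (∣⋃∣≤d*∣⋃∩H∣ d H (remove 𝒳 F) (PairwiseDisjoint-⊆ ⊆𝒳 disjoint) (∣_∣≤d ∘ ⊆𝒳) (hits ∘ ⊆𝒳))
          (*-monoʳ-≤ d (<⇒≤pred ∣W∩H∣<∣H∣))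
  where
  ⊆𝒳 : remove 𝒳 F ⊆ᶜ 𝒳
  ⊆𝒳 = proj₁ ∘ ∈-remove⁻
  W : Subset n
  W = ⋃ (remove 𝒳 F)
  ∣W∩H∣<∣H∣ : ∣ W ∩ H ∣ < ∣ H ∣
  ∣W∩H∣<∣H∣ = begin-strict
    ∣ W ∩ H ∣                 <⟨ m<n+m ∣ W ∩ H ∣ (p≢∅⇒0<∣p∣ (hits F∈𝒳)) ⟩
    ∣ F ∩ H ∣ + ∣ W ∩ H ∣     ≡⟨ p∩q≡∅⇒∣[p∪q]∩r∣≡∣p∩r∣+∣q∩r∣ (p∩⋃[remove]≡∅ disjoint F∈𝒳) H ⟨
    ∣ (F ∪ W) ∩ H ∣           ≤⟨ ∣p∩q∣≤∣q∣ (F ∪ W) H ⟩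
    ∣ H ∣                     ∎
    where open ≤-Reasoning

Unique⇒∃≢ : Unique 𝒳 → 2 ≤ length 𝒳 → ∀ S → ∃[ T ] (T ∈ˡ 𝒳 × S ≢ T)
Unique⇒∃≢ {𝒳 = A ∷ B ∷ _} ((A≢B ∷ _) ∷ _) _ S with S ≟ˢ A
... | yes refl = B , there (here refl) , A≢B
... | no S≢A   = A , here refl , S≢A
Unique⇒∃≢ {𝒳 = []}    _ ()        _
Unique⇒∃≢ {𝒳 = _ ∷ []} _ (s≤s ()) _

Sunflower-core⊆ : ∀ {𝓕 : List (Subset n)} {Y G G'} → Sunflower 𝓕 Y →
  G ∈ˡ 𝓕 → G' ∈ˡ 𝓕 → G ≢ G' → Y ⊆ G
Sunflower-core⊆ {G = G} {G'} (_ , core , _) G∈𝓕 G'∈𝓕 G≢G' = subst (_⊆ G) (core G∈𝓕 G'∈𝓕 G≢G') (p∩q⊆p G G')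

sunflower-avoids : ∀ {𝓕 : List (Subset n)} {Y W} → Sunflower 𝓕 Y → Empty (Y ∩ W) →
  ∣ W ∣ < length 𝓕 → ∃[ G ] (G ∈ˡ 𝓕 × Empty (G ∩ W))
sunflower-avoids {𝓕 = G ∷ 𝓕} {Y} {W} ((G≢ ∷ unique) , core , petal) Y∩W≡∅ ∣W∣<∣G∷𝓕∣
  with nonempty? (G ∩ W)
... | no G∩W≡∅ = G , here refl , G∩W≡∅
... | yes (x , x∈G∩W) =
  let x∈G , x∈W = x∈p∩q⁻ G W x∈G∩W
      G' , G'∈𝓕 , G'∩[W-x]≡∅ =
        sunflower-avoids (unique , (λ F∈ F'∈ → core (there F∈) (there F'∈)) , petal ∘ there)
          (q⊆r⇒p∩r≡∅⇒p∩q≡∅ (p─q⊆p W ⁅ x ⁆) Y∩W≡∅)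
          (<-≤-trans (x∈p⇒∣p-x∣<∣p∣ x∈W) (≤-pred ∣W∣<∣G∷𝓕∣))
      x∉G' : x ∉ G'
      x∉G' x∈G' = Y∩W≡∅ (x , x∈p∩q⁺ (subst (x ∈_) (core (here refl) (there G'∈𝓕) (All-lookup G≢ G'∈𝓕))
                                                   (x∈p∩q⁺ (x∈G , x∈G')) , x∈W))
  in G' , there G'∈𝓕 , x∉p⇒p∩[q-x]≡∅⇒p∩q≡∅ x∉G' G'∩[W-x]≡∅

sunflower-avoids-except : ∀ {𝓕 : List (Subset n)} {Y W} → Sunflower 𝓕 Y → F ∈ˡ 𝓕 → Empty (F ∩ W) →
  ∣ W ∣ + 2 ≤ length 𝓕 → ∃[ F' ] (F' ∈ˡ 𝓕 × F' ≢ F × Empty (F' ∩ W))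
sunflower-avoids-except {F = F} {𝓕 = 𝓕} {Y} {W} sunflower@(unique , _ , petal) F∈𝓕 F∩W≡∅ ∣W∣+2≤∣𝓕∣ =
  avoid (petal F∈𝓕)
  where
  Y∩W≡∅ : Empty (Y ∩ W)
  Y∩W≡∅ = let G , G∈𝓕 , F≢G = Unique⇒∃≢ unique (≤-trans (m≤n+m 2 ∣ W ∣) ∣W∣+2≤∣𝓕∣) F
          in p⊆q⇒q∩r≡∅⇒p∩r≡∅ (Sunflower-core⊆ sunflower F∈𝓕 G∈𝓕 F≢G) F∩W≡∅

  -- Adding a petal point of F to W rules out F itself.
  avoid : ∃[ x ] (x ∈ F × x ∉ Y) → ∃[ F' ] (F' ∈ˡ 𝓕 × F' ≢ F × Empty (F' ∩ W))
  avoid (x , x∈F , x∉Y) =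
    let F' , F'∈𝓕 , F'∩W⁺≡∅ = sunflower-avoids sunflower Y∩W⁺≡∅ ∣W⁺∣<∣𝓕∣
    in F' , F'∈𝓕 , (λ F'≡F → F'∩W⁺≡∅ (x , x∈p∩q⁺ (subst (x ∈_) (sym F'≡F) x∈F , x∈p∪q⁺ (inj₁ (x∈⁅x⁆ x)))))
            , q⊆r⇒p∩r≡∅⇒p∩q≡∅ (q⊆p∪q ⁅ x ⁆ W) F'∩W⁺≡∅
    where
    W⁺ : Subset _
    W⁺ = ⁅ x ⁆ ∪ W
    Y∩W⁺≡∅ : Empty (Y ∩ W⁺)
    Y∩W⁺≡∅ (y , y∈Y∩W⁺) with x∈p∩q⁻ Y W⁺ y∈Y∩W⁺
    ... | y∈Y , y∈W⁺ with x∈p∪q⁻ ⁅ x ⁆ W y∈W⁺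
    ...   | inj₁ y∈⁅x⁆ = x∉Y (subst (_∈ Y) (x∈⁅y⁆⇒x≡y x y∈⁅x⁆) y∈Y)
    ...   | inj₂ y∈W   = Y∩W≡∅ (y , x∈p∩q⁺ (y∈Y , y∈W))
    ∣W⁺∣<∣𝓕∣ : ∣ W⁺ ∣ < length 𝓕
    ∣W⁺∣<∣𝓕∣ = begin-strict
      ∣ ⁅ x ⁆ ∪ W ∣         ≤⟨ ∣p∪q∣≤∣p∣+∣q∣ ⁅ x ⁆ W ⟩
      ∣ ⁅ x ⁆ ∣ + ∣ W ∣     ≡⟨ cong (_+ ∣ W ∣) (∣⁅x⁆∣≡1 x) ⟩
      1 + ∣ W ∣             <⟨ ≤-reflexive (+-comm 2 ∣ W ∣) ⟩
      ∣ W ∣ + 2             ≤⟨ ∣W∣+2≤∣𝓕∣ ⟩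
      length 𝓕              ∎
      where open ≤-Reasoning

module _ {p : ℕ} {own : Fin n → Fin p} where

  Rejects-mono : ∀ {𝒮 𝒮' : List (Subset n)} {i} → (∀ {S} → S ∈ˡ 𝒮 → Internalᵢ own i S → S ∈ˡ 𝒮') →
    Rejects own 𝒮 i 𝒳 → Rejects own 𝒮' i 𝒳
  Rejects-mono 𝒮ᵢ⊆𝒮' (ℛ , ℐ , ℛ⊆𝒳 , ℐ⊆𝒮 , ℐ-internal , disjoint , gain) =
    ℛ , ℐ , ℛ⊆𝒳 , (λ S∈ℐ → 𝒮ᵢ⊆𝒮' (ℐ⊆𝒮 S∈ℐ) (ℐ-internal S∈ℐ)) , ℐ-internal , disjoint , gain

Solution : ∀ {p} → (Fin n → Fin p) → List (Subset n) → ℕ → List (Subset n) → Set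
Solution own 𝒮 k 𝒳 = 𝒳 ⊆ᶜ 𝒮 × PairwiseDisjoint 𝒳 × RejectionProof own 𝒮 𝒳 × k ≤ ∣ ⋃ 𝒳 ∣

module _ {p : ℕ} {own : Fin n → Fin p} {𝒮 : List (Subset n)} {k : ℕ} where

  Solution-remove⁺ : ¬ (F ∈ˡ 𝒳) → Solution own 𝒮 k 𝒳 → Solution own (remove 𝒮 F) k 𝒳
  Solution-remove⁺ {𝒳 = 𝒳} F∉𝒳 (𝒳⊆𝒮 , disjoint , rejection-proof , k≤∣⋃𝒳∣) =
    (λ S∈𝒳 → ∈-remove⁺ (𝒳⊆𝒮 S∈𝒳) (λ { refl → F∉𝒳 S∈𝒳 })) , disjoint ,
    (λ i → rejection-proof i ∘ Rejects-mono (λ S∈ _ → proj₁ (∈-remove⁻ S∈))) , k≤∣⋃𝒳∣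

  Solution-remove⁻ : ¬ Internal own F → Solution own (remove 𝒮 F) k 𝒳 → Solution own 𝒮 k 𝒳
  Solution-remove⁻ F-external (𝒳⊆𝒮∖F , disjoint , rejection-proof , k≤∣⋃𝒳∣) =
    proj₁ ∘ ∈-remove⁻ ∘ 𝒳⊆𝒮∖F , disjoint ,
    (λ i → rejection-proof i ∘ Rejects-mono (λ S∈ S-internal →
      ∈-remove⁺ S∈ (λ { refl → F-external (i , S-internal) }))) ,
    k≤∣⋃𝒳∣

record Exchange (a b : Subset n) (𝒫 𝒫' : List (Subset n)) : Set where
  field
    forth : ∀ {T} → T ∈ˡ 𝒫  → T ≢ a → T ∈ˡ 𝒫' × T ≢ b
    back  : ∀ {T} → T ∈ˡ 𝒫' → T ≢ b → T ∈ˡ 𝒫  × T ≢ a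
    apart : ∀ {T} → T ∈ˡ 𝒫  → T ≢ a → Empty (T ∩ a) × Empty (T ∩ b)

private
  variable
    a b : Subset n
    𝒫 𝒫' 𝒬 𝒬' : List (Subset n)

Exchange-sym : Exchange a b 𝒫 𝒫' → Exchange b a 𝒫' 𝒫
Exchange-sym e = record
  { forth = back
  ; back  = forth
  ; apart = λ T∈𝒫' T≢b → let T∈𝒫 , T≢a = back T∈𝒫' T≢b ; T∩a≡∅ , T∩b≡∅ = apart T∈𝒫 T≢a in T∩b≡∅ , T∩a≡∅
  }
  where open Exchange e

Exchange-++ : Exchange a b 𝒫 𝒫' → Exchange a b 𝒬 𝒬' → Exchange a b (𝒫 ++ 𝒬) (𝒫' ++ 𝒬')
Exchange-++ {𝒫 = 𝒫} {𝒫'} {𝒬} {𝒬'} e f = record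
  { forth = λ T∈ T≢a → [ (λ T∈𝒫 → map₁ ∈-++⁺ˡ (E.forth T∈𝒫 T≢a))
                       , (λ T∈𝒬 → map₁ (∈-++⁺ʳ 𝒫') (F.forth T∈𝒬 T≢a)) ]′ (∈-++⁻ 𝒫 T∈)
  ; back  = λ T∈ T≢b → [ (λ T∈𝒫' → map₁ ∈-++⁺ˡ (E.back T∈𝒫' T≢b))
                       , (λ T∈𝒬' → map₁ (∈-++⁺ʳ 𝒫) (F.back T∈𝒬' T≢b)) ]′ (∈-++⁻ 𝒫' T∈)
  ; apart = λ T∈ T≢a → [ (λ T∈𝒫 → E.apart T∈𝒫 T≢a) , (λ T∈𝒬 → F.apart T∈𝒬 T≢a) ]′ (∈-++⁻ 𝒫 T∈)
  }
  where
  module E = Exchange e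
  module F = Exchange f

Exchange-∖ᶜ : Exchange a b 𝒫 𝒫' → Exchange a b (𝒫 ∖ᶜ ℛ) (𝒫' ∖ᶜ ℛ)
Exchange-∖ᶜ {𝒫 = 𝒫} {𝒫'} {ℛ = ℛ} e = record
  { forth = λ T∈ T≢a → let T∈𝒫 , T∉ℛ = ∈-∖ᶜ⁻ {𝒳 = 𝒫} {ℛ} T∈ in map₁ (λ T∈𝒫' → ∈-∖ᶜ⁺ T∈𝒫' T∉ℛ) (forth T∈𝒫 T≢a)
  ; back  = λ T∈ T≢b → let T∈𝒫' , T∉ℛ = ∈-∖ᶜ⁻ {𝒳 = 𝒫'} {ℛ} T∈ in map₁ (λ T∈𝒫 → ∈-∖ᶜ⁺ T∈𝒫 T∉ℛ) (back T∈𝒫' T≢b)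
  ; apart = apart ∘ proj₁ ∘ ∈-∖ᶜ⁻ {𝒳 = 𝒫} {ℛ}
  }
  where open Exchange e

Exchange-PairwiseDisjoint : Exchange a b 𝒫 𝒫' → PairwiseDisjoint 𝒫' → PairwiseDisjoint 𝒫
Exchange-PairwiseDisjoint {a = a} e disjoint {S} {T} S∈𝒫 T∈𝒫 S≢T with S ≟ˢ a | T ≟ˢ a
... | yes refl | yes refl = ⊥-elim (S≢T refl)
... | yes refl | no T≢a   = subst Empty (∩-comm T a) (proj₁ (Exchange.apart e T∈𝒫 T≢a))
... | no S≢a   | yes refl = proj₁ (Exchange.apart e S∈𝒫 S≢a)
... | no S≢a   | no T≢a   =
  disjoint (proj₁ (Exchange.forth e S∈𝒫 S≢a)) (proj₁ (Exchange.forth e T∈𝒫 T≢a)) S≢T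

Exchange-⋃∪⊆ : Exchange a b 𝒫 𝒫' → b ∈ˡ 𝒫' → ⋃ 𝒫 ∪ b ⊆ ⋃ 𝒫' ∪ a
Exchange-⋃∪⊆ {a = a} {b = b} {𝒫 = 𝒫} e b∈𝒫' x∈ with x∈p∪q⁻ (⋃ 𝒫) b x∈
... | inj₂ x∈b  = x∈p∪q⁺ (inj₁ (x∈⋃⁺ b∈𝒫' x∈b))
... | inj₁ x∈⋃𝒫 with x∈⋃⁻ 𝒫 x∈⋃𝒫
...   | T , T∈𝒫 , x∈T with T ≟ˢ a
...     | yes refl = x∈p∪q⁺ (inj₂ x∈T)
...     | no T≢a   = x∈p∪q⁺ (inj₁ (x∈⋃⁺ (proj₁ (Exchange.forth e T∈𝒫 T≢a)) x∈T))

Exchange-⋃∩ : Exchange a b 𝒫 𝒫' → a ∈ˡ 𝒫 → ⋃ 𝒫 ∩ b ≡ a ∩ b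
Exchange-⋃∩ {a = a} {b = b} {𝒫 = 𝒫} e a∈𝒫 = ⊆-antisym ⊆a∩b (λ x∈a∩b →
  let x∈a , x∈b = x∈p∩q⁻ a b x∈a∩b in x∈p∩q⁺ (x∈⋃⁺ a∈𝒫 x∈a , x∈b))
  where
  ⊆a∩b : ⋃ 𝒫 ∩ b ⊆ a ∩ b
  ⊆a∩b x∈ with x∈p∩q⁻ (⋃ 𝒫) b x∈
  ... | x∈⋃𝒫 , x∈b with x∈⋃⁻ 𝒫 x∈⋃𝒫
  ...   | T , T∈𝒫 , x∈T with T ≟ˢ a
  ...     | yes refl = x∈p∩q⁺ (x∈T , x∈b)
  ...     | no T≢a   = ⊥-elim (proj₂ (Exchange.apart e T∈𝒫 T≢a) (_ , x∈p∩q⁺ (x∈T , x∈b)))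

Exchange-∣⋃∩∣ : Exchange a b 𝒫 𝒫' → a ∈ˡ 𝒫 → b ∈ˡ 𝒫' →
  ∀ u → ∣ ⋃ 𝒫 ∩ u ∣ + ∣ b ∩ u ∣ ≡ ∣ ⋃ 𝒫' ∩ u ∣ + ∣ a ∩ u ∣
Exchange-∣⋃∩∣ {a = a} {b = b} {𝒫 = 𝒫} {𝒫'} e a∈𝒫 b∈𝒫' u = begin
  ∣ ⋃ 𝒫 ∩ u ∣ + ∣ b ∩ u ∣                   ≡⟨ ∣[p∪q]∩r∣+∣[p∩q]∩r∣≡∣p∩r∣+∣q∩r∣ (⋃ 𝒫) b u ⟨
  ∣ (⋃ 𝒫 ∪ b) ∩ u ∣ + ∣ (⋃ 𝒫 ∩ b) ∩ u ∣     ≡⟨ cong₂ (λ s t → ∣ s ∩ u ∣ + ∣ t ∩ u ∣) unions intersections ⟩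
  ∣ (⋃ 𝒫' ∪ a) ∩ u ∣ + ∣ (⋃ 𝒫' ∩ a) ∩ u ∣   ≡⟨ ∣[p∪q]∩r∣+∣[p∩q]∩r∣≡∣p∩r∣+∣q∩r∣ (⋃ 𝒫') a u ⟩
  ∣ ⋃ 𝒫' ∩ u ∣ + ∣ a ∩ u ∣                  ∎
  where
  open ≡-Reasoning
  unions : ⋃ 𝒫 ∪ b ≡ ⋃ 𝒫' ∪ a
  unions = ⊆-antisym (Exchange-⋃∪⊆ e b∈𝒫') (Exchange-⋃∪⊆ (Exchange-sym e) a∈𝒫)
  intersections : ⋃ 𝒫 ∩ b ≡ ⋃ 𝒫' ∩ a
  intersections = trans (Exchange-⋃∩ e a∈𝒫) (trans (∩-comm a b) (sym (Exchange-⋃∩ (Exchange-sym e) b∈𝒫')))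

Exchange-∣⋃∣ : Exchange a b 𝒫 𝒫' → a ∈ˡ 𝒫 → b ∈ˡ 𝒫' → ∣ ⋃ 𝒫 ∣ + ∣ b ∣ ≡ ∣ ⋃ 𝒫' ∣ + ∣ a ∣
Exchange-∣⋃∣ {a = a} {b = b} {𝒫 = 𝒫} {𝒫'} e a∈𝒫 b∈𝒫' =
  subst₂ _≡_ (cong₂ _+_ (∣p∩⊤∣≡∣p∣ (⋃ 𝒫)) (∣p∩⊤∣≡∣p∣ b)) (cong₂ _+_ (∣p∩⊤∣≡∣p∣ (⋃ 𝒫')) (∣p∩⊤∣≡∣p∣ a))
    (Exchange-∣⋃∩∣ e a∈𝒫 b∈𝒫' ⊤)

module _ {p : ℕ} {own : Fin n → Fin p} {𝒮 𝓕 : List (Subset n)} {Y : Subset n}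
  (petals-avoided : ∀ {F S} → F ∈ˡ 𝓕 → S ∈ˡ 𝒮 → Internal own S → ∀ x → x ∈ S → x ∈ F → x ∉ Y → ⊥)
  where

  internal∩⊆core : ∀ {G T} → G ∈ˡ 𝓕 → T ∈ˡ 𝒮 → Internal own T → T ∩ G ⊆ Y
  internal∩⊆core {G} {T} G∈𝓕 T∈𝒮 T-internal {x} x∈T∩G = decidable-stable (x ∈ˢ? Y) λ x∉Y →
    let x∈T , x∈G = x∈p∩q⁻ T G x∈T∩G in petals-avoided G∈𝓕 T∈𝒮 T-internal x x∈T x∈G x∉Y

  Sunflower-external : Sunflower 𝓕 Y → 𝓕 ⊆ᶜ 𝒮 → ∀ {G} → G ∈ˡ 𝓕 → ¬ Internal own G
  Sunflower-external (_ , _ , petal) 𝓕⊆𝒮 G∈𝓕 G-internal =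
    let x , x∈G , x∉Y = petal G∈𝓕 in petals-avoided G∈𝓕 (𝓕⊆𝒮 G∈𝓕) G-internal x x∈G x∈G x∉Y

module Replacement {p : ℕ} (own : Fin n → Fin p) (𝒮 : List (Subset n)) {Y F F' : Subset n}
  (F-external : ¬ Internal own F) (F'-external : ¬ Internal own F')
  (internal∩F⊆Y : ∀ {T} → T ∈ˡ 𝒮 → Internal own T → T ∩ F ⊆ Y)
  (Y⊆F' : Y ⊆ F')
  (balanced : ∀ i → (Σ (Subset n) λ S → S ∈ˡ 𝒮 × Internalᵢ own i S × Nonempty (S ∩ Y)) →
    ∣ F ∩ U own i ∣ ≡ ∣ F' ∩ U own i ∣)
  {𝒳 : List (Subset n)} (F∈𝒳 : F ∈ˡ 𝒳) (𝒳-disjoint : PairwiseDisjoint 𝒳)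
  (F'≢F : F' ≢ F) (F'-nonempty : Nonempty F') (F'∩W≡∅ : Empty (F' ∩ ⋃ (remove 𝒳 F)))
  where

  𝒳' : List (Subset n)
  𝒳' = F' ∷ remove 𝒳 F

  T∩F'≡∅ : ∀ {T} → T ∈ˡ 𝒳 → T ≢ F → Empty (T ∩ F')
  T∩F'≡∅ {T} T∈𝒳 T≢F =
    subst Empty (∩-comm F' T) (q⊆r⇒p∩r≡∅⇒p∩q≡∅ (x∈⋃⁺ (∈-remove⁺ T∈𝒳 T≢F)) F'∩W≡∅)

  F'∉𝒳 : ¬ (F' ∈ˡ 𝒳)
  F'∉𝒳 F'∈𝒳 = let x , x∈F' = F'-nonempty in T∩F'≡∅ F'∈𝒳 F'≢F (x , x∈p∩q⁺ (x∈F' , x∈F'))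

  F∉𝒳' : ¬ (F ∈ˡ 𝒳')
  F∉𝒳' (here F≡F') = F'≢F (sym F≡F')
  F∉𝒳' (there F∈)  = proj₂ (∈-remove⁻ {𝒳 = 𝒳} F∈) refl

  𝒳⇄𝒳' : Exchange F F' 𝒳 𝒳'
  𝒳⇄𝒳' = record
    { forth = λ T∈𝒳 T≢F → there (∈-remove⁺ T∈𝒳 T≢F) , λ { refl → F'∉𝒳 T∈𝒳 }
    ; back  = λ { (here refl) T≢F' → ⊥-elim (T≢F' refl) ; (there T∈) _ → ∈-remove⁻ T∈ }
    ; apart = λ T∈𝒳 T≢F → 𝒳-disjoint T∈𝒳 F∈𝒳 T≢F , T∩F'≡∅ T∈𝒳 T≢F
    }

  internal≢F : ∀ {i T} → Internalᵢ own i T → T ≢ F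
  internal≢F {i} T-internal refl = F-external (i , T-internal)

  internal≢F' : ∀ {i T} → Internalᵢ own i T → T ≢ F'
  internal≢F' {i} T-internal refl = F'-external (i , T-internal)

  internal∩F≡∅ : ∀ {T V} → T ∈ˡ 𝒮 → Internal own T → Y ⊆ V → Empty (T ∩ V) → Empty (T ∩ F)
  internal∩F≡∅ {T} T∈𝒮 T-internal Y⊆V T∩V≡∅ (x , x∈T∩F) =
    T∩V≡∅ (x , x∈p∩q⁺ (proj₁ (x∈p∩q⁻ T F x∈T∩F) , Y⊆V (internal∩F⊆Y T∈𝒮 T-internal x∈T∩F)))

  module Transfer {i : Fin p} {ℛ ℐ : List (Subset n)} (ℛ⊆𝒳' : ℛ ⊆ᶜ 𝒳') (ℐ⊆𝒮 : ℐ ⊆ᶜ 𝒮)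
    (ℐ-internal : ∀ {S} → S ∈ˡ ℐ → Internalᵢ own i S)
    (𝒵-disjoint : PairwiseDisjoint ((𝒳' ∖ᶜ ℛ) ++ ℐ))
    (gain : coverᵢ own i 𝒳' < coverᵢ own i ((𝒳' ∖ᶜ ℛ) ++ ℐ))
    where

    Uᵢ : Subset n
    Uᵢ = U own i

    𝒵 : List (Subset n)
    𝒵 = (𝒳' ∖ᶜ ℛ) ++ ℐ

    exchange-cover : ∣ ⋃ 𝒳 ∩ Uᵢ ∣ + ∣ F' ∩ Uᵢ ∣ ≡ ∣ ⋃ 𝒳' ∩ Uᵢ ∣ + ∣ F ∩ Uᵢ ∣
    exchange-cover = Exchange-∣⋃∩∣ 𝒳⇄𝒳' F∈𝒳 (here refl) Uᵢ

    -- F' is kept, so the added internal sets miss F'; meeting F only inside Y ⊆ F', they miss F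
    -- as well, and F can take the place of F' in the agent's new collection.
    rejects-keeping-F' : ¬ (F' ∈ˡ ℛ) → Rejects own 𝒮 i 𝒳
    rejects-keeping-F' F'∉ℛ =
      ℛ , ℐ , ℛ⊆𝒳 , ℐ⊆𝒮 , ℐ-internal , Exchange-PairwiseDisjoint 𝒵₀⇄𝒵 𝒵-disjoint , more
      where
      ℛ⊆𝒳 : ℛ ⊆ᶜ 𝒳
      ℛ⊆𝒳 T∈ℛ = proj₁ (Exchange.back 𝒳⇄𝒳' (ℛ⊆𝒳' T∈ℛ) λ { refl → F'∉ℛ T∈ℛ })

      𝒵₀ : List (Subset n)
      𝒵₀ = (𝒳 ∖ᶜ ℛ) ++ ℐ

      F'∈𝒵 : F' ∈ˡ 𝒵
      F'∈𝒵 = ∈-++⁺ˡ (∈-∖ᶜ⁺ (here refl) F'∉ℛ)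

      F∈𝒵₀ : F ∈ˡ 𝒵₀
      F∈𝒵₀ = ∈-++⁺ˡ (∈-∖ᶜ⁺ F∈𝒳 (F∉𝒳' ∘ ℛ⊆𝒳'))

      ℐ∩F'≡∅ : ∀ {T} → T ∈ˡ ℐ → Empty (T ∩ F')
      ℐ∩F'≡∅ T∈ℐ = 𝒵-disjoint (∈-++⁺ʳ (𝒳' ∖ᶜ ℛ) T∈ℐ) F'∈𝒵 (internal≢F' (ℐ-internal T∈ℐ))

      ℐ⇄ℐ : Exchange F F' ℐ ℐ
      ℐ⇄ℐ = record
        { forth = λ T∈ℐ _ → T∈ℐ , internal≢F' (ℐ-internal T∈ℐ)
        ; back  = λ T∈ℐ _ → T∈ℐ , internal≢F (ℐ-internal T∈ℐ)
        ; apart = λ T∈ℐ _ → internal∩F≡∅ (ℐ⊆𝒮 T∈ℐ) (i , ℐ-internal T∈ℐ) Y⊆F' (ℐ∩F'≡∅ T∈ℐ) , ℐ∩F'≡∅ T∈ℐ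
        }

      𝒵₀⇄𝒵 : Exchange F F' 𝒵₀ 𝒵
      𝒵₀⇄𝒵 = Exchange-++ (Exchange-∖ᶜ 𝒳⇄𝒳') ℐ⇄ℐ

      more : ∣ ⋃ 𝒳 ∩ Uᵢ ∣ < ∣ ⋃ 𝒵₀ ∩ Uᵢ ∣
      more = +-cancelʳ-< ∣ F' ∩ Uᵢ ∣ _ _ (begin-strict
        ∣ ⋃ 𝒳 ∩ Uᵢ ∣ + ∣ F' ∩ Uᵢ ∣   ≡⟨ exchange-cover ⟩
        ∣ ⋃ 𝒳' ∩ Uᵢ ∣ + ∣ F ∩ Uᵢ ∣   <⟨ +-monoˡ-< ∣ F ∩ Uᵢ ∣ gain ⟩
        ∣ ⋃ 𝒵 ∩ Uᵢ ∣ + ∣ F ∩ Uᵢ ∣    ≡⟨ Exchange-∣⋃∩∣ 𝒵₀⇄𝒵 F∈𝒵₀ F'∈𝒵 Uᵢ ⟨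
        ∣ ⋃ 𝒵₀ ∩ Uᵢ ∣ + ∣ F' ∩ Uᵢ ∣  ∎)
        where open ≤-Reasoning

    module _ (F'∈ℛ : F' ∈ˡ ℛ) where

      ℛ₀ : List (Subset n)
      ℛ₀ = remove ℛ F'

      ℛ₀⊆𝒳 : ℛ₀ ⊆ᶜ 𝒳
      ℛ₀⊆𝒳 T∈ℛ₀ = let T∈ℛ , T≢F' = ∈-remove⁻ T∈ℛ₀ in proj₁ (Exchange.back 𝒳⇄𝒳' (ℛ⊆𝒳' T∈ℛ) T≢F')

      kept⊆ : (𝒳' ∖ᶜ ℛ) ⊆ᶜ (𝒳 ∖ᶜ (F ∷ ℛ₀))
      kept⊆ T∈ =
        let T∈𝒳' , T∉ℛ = ∈-∖ᶜ⁻ {𝒳 = 𝒳'} {ℛ} T∈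
            T∈𝒳 , T≢F = Exchange.back 𝒳⇄𝒳' T∈𝒳' (λ { refl → T∉ℛ F'∈ℛ })
        in ∈-∖ᶜ⁺ T∈𝒳 λ { (here T≡F) → T≢F T≡F ; (there T∈ℛ₀) → T∉ℛ (proj₁ (∈-remove⁻ T∈ℛ₀)) }

      ⊆kept : (𝒳 ∖ᶜ (F ∷ ℛ₀)) ⊆ᶜ (𝒳' ∖ᶜ ℛ)
      ⊆kept T∈ =
        let T∈𝒳 , T∉F∷ℛ₀ = ∈-∖ᶜ⁻ {𝒳 = 𝒳} {F ∷ ℛ₀} T∈
            T∈𝒳' , T≢F' = Exchange.forth 𝒳⇄𝒳' T∈𝒳 (T∉F∷ℛ₀ ∘ here)
        in ∈-∖ᶜ⁺ {ℛ = ℛ} T∈𝒳' (λ T∈ℛ → T∉F∷ℛ₀ (there (∈-remove⁺ T∈ℛ T≢F')))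

      -- By (2), F and F' cover equally much of Uᵢ, so rejecting F in place of F' does the job.
      rejects-swapping : ∃[ S ] (S ∈ˡ ℐ × Nonempty (S ∩ Y)) → Rejects own 𝒮 i 𝒳
      rejects-swapping (S , S∈ℐ , S∩Y≢∅) =
        F ∷ ℛ₀ , ℐ , ∈-∷⁺ʳ F∈𝒳 ℛ₀⊆𝒳 , ℐ⊆𝒮 , ℐ-internal , PairwiseDisjoint-⊆ (++⁺ˡ ℐ ⊆kept) 𝒵-disjoint ,
        more
        where
        same-cover : ∣ ⋃ 𝒳 ∩ Uᵢ ∣ ≡ ∣ ⋃ 𝒳' ∩ Uᵢ ∣
        same-cover = +-cancelʳ-≡ ∣ F ∩ Uᵢ ∣ _ _
          (trans (cong (∣ ⋃ 𝒳 ∩ Uᵢ ∣ +_) (balanced i (S , ℐ⊆𝒮 S∈ℐ , ℐ-internal S∈ℐ , S∩Y≢∅))) exchange-cover)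

        more : ∣ ⋃ 𝒳 ∩ Uᵢ ∣ < ∣ ⋃ ((𝒳 ∖ᶜ (F ∷ ℛ₀)) ++ ℐ) ∩ Uᵢ ∣
        more = begin-strict
          ∣ ⋃ 𝒳 ∩ Uᵢ ∣                           ≡⟨ same-cover ⟩
          ∣ ⋃ 𝒳' ∩ Uᵢ ∣                          <⟨ gain ⟩
          ∣ ⋃ 𝒵 ∩ Uᵢ ∣                           ≡⟨ cong (λ V → ∣ V ∩ Uᵢ ∣) (⋃-cong (++⁺ˡ ℐ kept⊆) (++⁺ˡ ℐ ⊆kept)) ⟩
          ∣ ⋃ ((𝒳 ∖ᶜ (F ∷ ℛ₀)) ++ ℐ) ∩ Uᵢ ∣       ∎
          where open ≤-Reasoning

      -- No set of ℐ meets Y, hence none meets F: the agent can keep F and gain ∣ F ∩ Uᵢ ∣ more.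
      rejects-keeping-F : (∀ {S} → S ∈ˡ ℐ → Empty (S ∩ Y)) → Rejects own 𝒮 i 𝒳
      rejects-keeping-F ℐ∩Y≡∅ =
        ℛ₀ , ℐ , ℛ₀⊆𝒳 , ℐ⊆𝒮 , ℐ-internal ,
        PairwiseDisjoint-⊆ 𝒵₀⊆F∷𝒵 (PairwiseDisjoint-∷ F∩𝒵≡∅ 𝒵-disjoint) , more
        where
        𝒵₀ : List (Subset n)
        𝒵₀ = (𝒳 ∖ᶜ ℛ₀) ++ ℐ

        F∉ℛ₀ : ¬ (F ∈ˡ ℛ₀)
        F∉ℛ₀ = F∉𝒳' ∘ ℛ⊆𝒳' ∘ proj₁ ∘ ∈-remove⁻

        𝒵₀⊆F∷𝒵 : 𝒵₀ ⊆ᶜ (F ∷ 𝒵)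
        𝒵₀⊆F∷𝒵 = ⊆-trans (++⁺ˡ ℐ (∖ᶜ-⊆-∷ {𝒳 = 𝒳} {ℛ₀})) (∷⁺ʳ F (++⁺ˡ ℐ ⊆kept))

        F∷𝒵⊆𝒵₀ : (F ∷ 𝒵) ⊆ᶜ 𝒵₀
        F∷𝒵⊆𝒵₀ = ⊆-trans (∷⁺ʳ F (++⁺ˡ ℐ kept⊆)) (++⁺ˡ ℐ (∷-∖ᶜ-⊆ F∈𝒳 F∉ℛ₀))

        F∩𝒵≡∅ : ∀ {T} → T ∈ˡ 𝒵 → Empty (F ∩ T)
        F∩𝒵≡∅ {T} T∈𝒵 with ∈-++⁻ (𝒳' ∖ᶜ ℛ) T∈𝒵
        ... | inj₁ T∈kept =
          let T∈𝒳 , T∉F∷ℛ₀ = ∈-∖ᶜ⁻ {𝒳 = 𝒳} {F ∷ ℛ₀} (kept⊆ T∈kept)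
          in 𝒳-disjoint F∈𝒳 T∈𝒳 (λ F≡T → T∉F∷ℛ₀ (here (sym F≡T)))
        ... | inj₂ T∈ℐ =
          subst Empty (∩-comm T F) (internal∩F≡∅ (ℐ⊆𝒮 T∈ℐ) (i , ℐ-internal T∈ℐ) (λ y∈Y → y∈Y) (ℐ∩Y≡∅ T∈ℐ))

        more : ∣ ⋃ 𝒳 ∩ Uᵢ ∣ < ∣ ⋃ 𝒵₀ ∩ Uᵢ ∣
        more = begin-strict
          ∣ ⋃ 𝒳 ∩ Uᵢ ∣                  ≤⟨ m≤m+n ∣ ⋃ 𝒳 ∩ Uᵢ ∣ ∣ F' ∩ Uᵢ ∣ ⟩
          ∣ ⋃ 𝒳 ∩ Uᵢ ∣ + ∣ F' ∩ Uᵢ ∣    ≡⟨ exchange-cover ⟩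
          ∣ ⋃ 𝒳' ∩ Uᵢ ∣ + ∣ F ∩ Uᵢ ∣    <⟨ +-monoˡ-< ∣ F ∩ Uᵢ ∣ gain ⟩
          ∣ ⋃ 𝒵 ∩ Uᵢ ∣ + ∣ F ∩ Uᵢ ∣     ≡⟨ +-comm ∣ ⋃ 𝒵 ∩ Uᵢ ∣ ∣ F ∩ Uᵢ ∣ ⟩
          ∣ F ∩ Uᵢ ∣ + ∣ ⋃ 𝒵 ∩ Uᵢ ∣     ≡⟨ p∩q≡∅⇒∣[p∪q]∩r∣≡∣p∩r∣+∣q∩r∣ (p∩⋃≡∅ F∩𝒵≡∅) Uᵢ ⟨
          ∣ (F ∪ ⋃ 𝒵) ∩ Uᵢ ∣            ≡⟨ cong (λ V → ∣ V ∩ Uᵢ ∣) (⋃-cong F∷𝒵⊆𝒵₀ 𝒵₀⊆F∷𝒵) ⟩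
          ∣ ⋃ 𝒵₀ ∩ Uᵢ ∣                 ∎
          where open ≤-Reasoning

  Rejects-transfer : ∀ {i} → Rejects own 𝒮 i 𝒳' → Rejects own 𝒮 i 𝒳
  Rejects-transfer {i} (ℛ , ℐ , ℛ⊆𝒳' , ℐ⊆𝒮 , ℐ-internal , 𝒵-disjoint , gain) =
    decide (F' ∈ˡ? ℛ) (any? (λ S → nonempty? (S ∩ Y)) ℐ)
    where
    open Transfer ℛ⊆𝒳' ℐ⊆𝒮 ℐ-internal 𝒵-disjoint gain
    decide : Dec (F' ∈ˡ ℛ) → Dec (Any (λ S → Nonempty (S ∩ Y)) ℐ) → Rejects own 𝒮 i 𝒳
    decide (no F'∉ℛ)  _            = rejects-keeping-F' F'∉ℛ
    decide (yes F'∈ℛ) (yes meets)  = rejects-swapping F'∈ℛ (find meets)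
    decide (yes F'∈ℛ) (no ¬meets)  = rejects-keeping-F F'∈ℛ (λ S∈ℐ S∩Y≢∅ → ¬meets (lose S∈ℐ S∩Y≢∅))

  Solution-replace : ∀ {k} → Solution own 𝒮 k 𝒳 → F' ∈ˡ 𝒮 → ∣ F ∣ ≤ ∣ F' ∣ → Solution own (remove 𝒮 F) k 𝒳'
  Solution-replace {k} (𝒳⊆𝒮 , _ , rejection-proof , k≤∣⋃𝒳∣) F'∈𝒮 ∣F∣≤∣F'∣ =
    𝒳'⊆𝒮∖F , Exchange-PairwiseDisjoint (Exchange-sym 𝒳⇄𝒳') 𝒳-disjoint ,
    (λ i → rejection-proof i ∘ Rejects-transfer ∘ Rejects-mono (λ S∈ _ → proj₁ (∈-remove⁻ S∈))) ,
    ≤-trans k≤∣⋃𝒳∣ ∣⋃𝒳∣≤∣⋃𝒳'∣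
    where
    𝒳'⊆𝒮∖F : 𝒳' ⊆ᶜ remove 𝒮 F
    𝒳'⊆𝒮∖F (here refl) = ∈-remove⁺ F'∈𝒮 F'≢F
    𝒳'⊆𝒮∖F (there T∈)  = let T∈𝒳 , T≢F = ∈-remove⁻ T∈ in ∈-remove⁺ (𝒳⊆𝒮 T∈𝒳) T≢F

    ∣⋃𝒳∣≤∣⋃𝒳'∣ : ∣ ⋃ 𝒳 ∣ ≤ ∣ ⋃ 𝒳' ∣
    ∣⋃𝒳∣≤∣⋃𝒳'∣ = +-cancelʳ-≤ ∣ F' ∣ _ _ (begin
      ∣ ⋃ 𝒳 ∣ + ∣ F' ∣   ≡⟨ Exchange-∣⋃∣ 𝒳⇄𝒳' F∈𝒳 (here refl) ⟩
      ∣ ⋃ 𝒳' ∣ + ∣ F ∣   ≤⟨ +-monoʳ-≤ ∣ ⋃ 𝒳' ∣ ∣F∣≤∣F'∣ ⟩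
      ∣ ⋃ 𝒳' ∣ + ∣ F' ∣  ∎)
      where open ≤-Reasoning

lemma10 : ∀ {n p : ℕ} (own : Fin n → Fin p) (𝒮 : List (Subset n)) (d k : ℕ) →
    SizeBounded d 𝒮 →
    (Σ (Subset n) λ H → HittingSet 𝒮 H × ∣ H ∣ ≤ k * d) →
    (𝓕 : List (Subset n)) (Y : Subset n) →
    (∀ {F} → F ∈ˡ 𝓕 → F ∈ˡ 𝒮) →
    Sunflower 𝓕 Y →
    length 𝓕 ≡ d * (k * d ∸ 1) + 2 →
    (∀ {F S} → F ∈ˡ 𝓕 → S ∈ˡ 𝒮 → Internal own S →
      ∀ x → x ∈ S → x ∈ F → x ∉ Y → ⊥) →
    (∀ i → (Σ (Subset n) λ S → S ∈ˡ 𝒮 × Internalᵢ own i S × Nonempty (S ∩ Y)) →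
      ∀ {F F'} → F ∈ˡ 𝓕 → F' ∈ˡ 𝓕 → ∣ F ∩ U own i ∣ ≡ ∣ F' ∩ U own i ∣) →
    (F : Subset n) → F ∈ˡ 𝓕 → (∀ {F'} → F' ∈ˡ 𝓕 → ∣ F ∣ ≤ ∣ F' ∣) →
    YesInstance own 𝒮 k ⇔ YesInstance own (remove 𝒮 F) k
lemma10 own 𝒮 d k ∣𝒮∣≤d (H , hits , ∣H∣≤kd) 𝓕 Y 𝓕⊆𝒮 sunflower ∣𝓕∣≡ petals-avoided balanced F F∈𝓕 F-minimal =
  mk⇔ forward (map₂ (Solution-remove⁻ (external F∈𝓕)))
  where
  external : ∀ {G} → G ∈ˡ 𝓕 → ¬ Internal own G
  external = Sunflower-external petals-avoided sunflower 𝓕⊆𝒮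

  forward : YesInstance own 𝒮 k → YesInstance own (remove 𝒮 F) k
  forward (𝒳 , solution@(𝒳⊆𝒮 , 𝒳-disjoint , _)) with F ∈ˡ? 𝒳
  ... | no F∉𝒳  = 𝒳 , Solution-remove⁺ F∉𝒳 solution
  ... | yes F∈𝒳 with sunflower-avoids-except sunflower F∈𝓕 (p∩⋃[remove]≡∅ 𝒳-disjoint F∈𝒳)
                       (subst (_ ≤_) (sym ∣𝓕∣≡) (+-monoˡ-≤ 2 (≤-trans
                         (∣⋃[remove]∣≤d*pred∣H∣ d H 𝒳-disjoint (∣𝒮∣≤d ∘ 𝒳⊆𝒮) (hits ∘ 𝒳⊆𝒮) F∈𝒳)
                         (*-monoʳ-≤ d (∸-monoˡ-≤ 1 ∣H∣≤kd)))))
  ...   | F' , F'∈𝓕 , F'≢F , F'∩W≡∅ =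
    F' ∷ remove 𝒳 F ,
    Replacement.Solution-replace own 𝒮 (external F∈𝓕) (external F'∈𝓕) (internal∩⊆core petals-avoided F∈𝓕)
      (Sunflower-core⊆ sunflower F'∈𝓕 F∈𝓕 F'≢F) (λ i S → balanced i S F∈𝓕 F'∈𝓕)
      F∈𝒳 𝒳-disjoint F'≢F (map₂ proj₁ (proj₂ (proj₂ sunflower) F'∈𝓕)) F'∩W≡∅
      solution (𝓕⊆𝒮 F'∈𝓕) (F-minimal F'∈𝓕)
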